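{- Let $T$ be a tree with maximum degree $3$ having at least two vertices of degree $3$. Let $u,v$ be major vertices joined by a closed $k$-chain with $k\ge 2$. Suppose the chain oriented from $u$ to $v$ and the other two chains incident to $v$ give weights $a$, $d$, $d'$ to $v$, respectively, and the chain oriented from $v$ to $u$ and the other two chains incident to $u$ give weights $b$, $c$, $c'$ to $u$, respectively, where $a,b,c,c',d,d'$ are all positive. Then $u$ is bad if and only if $v$ is bad (equivalently, $u$ is good if and only if $v$ is good).
   Context: Let $T$ be a tree with maximum degree $3$. A major vertex is a vertex of degree $3$; a leaf is a vertex of degree $1$. For $k\ge 0$, a $k$-chain (or $uv$-chain) is a path $u x_1 x_2\cdots x_k v$ with $d(u)\ne 2$, $d(v)\ne 2$ and $d(x_i)=2$ for all $i$ (a $0$-chain is an edge $uv$). A chain is closed if both ends are major vertices, and open if one end is a leaf and the other is a major vertex. Weights (defined when $T$ has at least two major vertices). Each major vertex $v$ lies on exactly three chains, and each of them gives $v$ a weight in $\{0,1,2,3,5,6,10,15\}$, defined recursively as follows. An open chain gives weight $1$ to its major end. A closed $k$-chain between major vertices $u,v$, oriented from $u$ to $v$ (written $[u(k)v]$), gives to $v$: weight $6$ if $k=0$; weight $15$ if $k=1$; if $k\ge 2$, let $a,b$ be the weights given to $u$ by the two other chains at $u$ (these depend only on the part of $T$ on the side of $u$ away from $v$), and define the type $(c,k)$ of $[u(k)v]$ by: $c=0$ if $a=0$ or $b=0$; otherwise $c=1$ if $a,b\in\{1,2,3,5\}$ and $\gcd(a,b)=1$; $c=a$ if $a\in\{6,10,15\}$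 and $\gcd(a,b)=1$ (symmetrically $c=b$ if $b\in\{6,10,15\}$ and $\gcd(a,b)=1$); $c=\gcd(a,b)$ if $\gcd(a,b)\in\{2,3,5\}$; $c=0$ if $\gcd(a,b)\in\{6,10,15\}$. The weight then given to $v$ is: $1$ for types $(1,2)$, $(1,k\ge4)$, $(2,k\ge7)$, $(3,k\ge7)$, $(5,k\ge6)$, $(6,k\ge5)$, $(10,k\ge4)$, $(15,k\ge5)$; $2$ for $(1,3)$, $(2,5)$, $(3,6)$, $(5,3)$, $(6,2)$, $(10,3)$, $(15,3)$; $3$ for $(2,6)$, $(3,5)$, $(10,2)$, $(15,4)$; $5$ for $(2,4)$, $(5,5)$, $(6,4)$, $(15,2)$; $6$ for $(2,2)$, $(3,3)$, $(5,4)$, $(6,3)$; $10$ for $(3,2)$; $15$ for $(3,4)$, $(5,2)$; $0$ for $(0,k\ge2)$ and $(2,3)$. A major vertex $u$ of $T$ is bad if (B1) some closed chain incident to $u$, oriented away from $u$, is of type $(2,3)$; or (B2) two of the three chains incident to $u$ give $u$ the same weight and this weight is $6$, $10$ or $15$; or (B3) the three weights received by $u$ are all positive and their greatest common divisor is greater than $1$. A major vertex is good if it is not bad. -}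

module Defs where

open import Data.Nat using (ℕ; zero; suc; _<_; _≡ᵇ_)
open import Data.Nat.GCD using (gcd)
open import Data.Bool using (Bool; true; false; if_then_else_; _∨_)
open import Data.Product using (_×_; _,_)
open import Data.Sum using (_⊎_)
open import Relation.Binary.PropositionalEquality using (_≡_)

-- A `Branch` is the part of the tree hanging off a vertex w through one
-- of its neighbours x (x is the root of the branch):
--   leaf       : x is a leaf (degree 1)
--   path B     : x has degree 2, and the rest hangs off x as B
--   fork B B'  : x has degree 3 (major), with the two other branches B, B'
-- Every finite tree of maximum degree ≤ 3, looked at from one of its
-- vertices, is described (up to isomorphism) this way.

data Branch : Set where
  leaf : Branch
  path : Branch → Branch
  fork : Branch → Branch → Branch

paths : ℕ → Branch → Branch
paths zero    B = B
paths (suc k) B = path (paths k B)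

-- The chain from w into the branch: its length k (number of internal
-- degree-2 vertices), and whether it is closed (ends at a major vertex).
chainLen : Branch → ℕ
chainLen leaf       = 0
chainLen (path B)   = suc (chainLen B)
chainLen (fork _ _) = 0

data Closed : Branch → Set where
  closed-path : ∀ {B} → Closed B → Closed (path B)
  closed-fork : ∀ {B B'} → Closed (fork B B')

-- The type (c , k) of a closed chain [u(k)v], k ≥ 2, where a, b are the
-- weights given to u by its two other chains.

inSet6-10-15 : ℕ → Bool
inSet6-10-15 n = (n ≡ᵇ 6) ∨ (n ≡ᵇ 10) ∨ (n ≡ᵇ 15)

inSet2-3-5 : ℕ → Bool
inSet2-3-5 n = (n ≡ᵇ 2) ∨ (n ≡ᵇ 3) ∨ (n ≡ᵇ 5)

-- the component c of the type (weights lie in {0,1,2,3,5,6,10,15})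
typeC : ℕ → ℕ → ℕ
typeC a b =
  if (a ≡ᵇ 0) ∨ (b ≡ᵇ 0) then 0
  else if gcd a b ≡ᵇ 1
       then (if inSet6-10-15 a then a
             else if inSet6-10-15 b then b
             else 1)
       else (if inSet2-3-5 (gcd a b) then gcd a b else 0)

chainType : ℕ → ℕ → ℕ → ℕ × ℕ
chainType a b k = typeC a b , k

-- weight given to v by a closed chain of type (c , k), k ≥ 2
typeWeight : ℕ → ℕ → ℕ
typeWeight 1 2 = 1
typeWeight 1 3 = 2
typeWeight 1 _ = 1
typeWeight 2 2 = 6
typeWeight 2 3 = 0
typeWeight 2 4 = 5
typeWeight 2 5 = 2
typeWeight 2 6 = 3
typeWeight 2 _ = 1
typeWeight 3 2 = 10
typeWeight 3 3 = 6
typeWeight 3 4 = 15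
typeWeight 3 5 = 3
typeWeight 3 6 = 2
typeWeight 3 _ = 1
typeWeight 5 2 = 15
typeWeight 5 3 = 2
typeWeight 5 4 = 6
typeWeight 5 5 = 5
typeWeight 5 _ = 1
typeWeight 6 2 = 2
typeWeight 6 3 = 6
typeWeight 6 4 = 5
typeWeight 6 _ = 1
typeWeight 10 2 = 3
typeWeight 10 3 = 2
typeWeight 10 _ = 1
typeWeight 15 2 = 5
typeWeight 15 3 = 2
typeWeight 15 4 = 3
typeWeight 15 _ = 1
typeWeight _ _ = 0   -- c = 0 (other values of c never occur)

-- weight given to v by a closed k-chain [u(k)v], where a, b are the
-- weights given to u by the two other chains at u
closedWeight : ℕ → ℕ → ℕ → ℕ
closedWeight zero          a b = 6
closedWeight (suc zero)    a b = 15
closedWeight k@(suc (suc _)) a b = typeWeight (typeC a b) k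

-- wt k B: weight given to w by the chain running into branch B, having
-- already passed k degree-2 vertices.
wt : ℕ → Branch → ℕ
wt k leaf        = 1                                  -- open chain
wt k (path B)    = wt (suc k) B
wt k (fork B B') = closedWeight k (wt 0 B) (wt 0 B')   -- closed chain

weight : Branch → ℕ
weight = wt 0

-- Bad vertices: a major vertex with its three branches X, Y, Z.

B1at : Branch → Branch → Branch → Set
B1at X Y Z = Closed X × chainType (weight Y) (weight Z) (chainLen X) ≡ (2 , 3)

Big : ℕ → Set
Big n = n ≡ 6 ⊎ n ≡ 10 ⊎ n ≡ 15

SameBig : ℕ → ℕ → Set
SameBig m n = m ≡ n × Big m

data Bad (X Y Z : Branch) : Set where
  b1-X : B1at X Y Z → Bad X Y Z
  b1-Y : B1at Y X Z → Bad X Y Z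
  b1-Z : B1at Z X Y → Bad X Y Z
  b2-XY : SameBig (weight X) (weight Y) → Bad X Y Z
  b2-XZ : SameBig (weight X) (weight Z) → Bad X Y Z
  b2-YZ : SameBig (weight Y) (weight Z) → Bad X Y Z
  b3 : 0 < weight X → 0 < weight Y → 0 < weight Z →
       1 < gcd (gcd (weight X) (weight Y)) (weight Z) → Bad X Y Z

-- Every weight lies in {0,1,2,3,5,6,10,15}, and the weight a closed k-chain
-- passes on depends on k only through min k 7. Condition (B1) at a vertex
-- forces all three of its weights to be even: a chain of type (2,3) comes from
-- two even weights and, having length 3, itself carries an even weight. So for
-- positive weights (B1) is subsumed by (B3), and badness of u (resp. v) is a
-- property of its weights (b, c, c') (resp. (a, d, d')). The equivalence then
-- becomes a finite check over c, c', d, d' and k ∈ {2, …, 7}.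
module Submission where

open import Defs
open import Data.Nat using (ℕ; zero; suc; _+_; _⊓_; _≤_; _<_; _≤?_; _<?_; _≟_; s≤s; z≤n; ≢-nonZero)
open import Data.Nat.Properties using (+-suc; +-identityʳ; m⊓n≤m; ⊓-glb; <-≤-trans; <⇒≢)
open import Data.Nat.Divisibility using (_∣_; _∣?_; ∣⇒≤)
open import Data.Nat.GCD using (gcd; gcd-greatest; gcd[m,n]≡0⇒m≡0)
open import Data.List using (List; []; _∷_; upTo)
open import Data.List.Membership.DecPropositional _≟_ using (_∈_; _∈?_)
open import Data.List.Membership.Propositional.Properties using (∈-upTo⁺)
open import Data.List.Relation.Unary.All using (All; []; _∷_; all?; lookup)
open import Data.List.Relation.Unary.Any using (here; there)
open import Data.Product using (_×_; _,_; ∃₂)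
open import Data.Product.Properties using (,-injective)
open import Data.Sum using (_⊎_; inj₁; inj₂)
open import Function using (_∘_)
open import Function.Bundles using (_⇔_; mk⇔; module Equivalence)
open import Relation.Binary.PropositionalEquality using (_≡_; _≢_; refl; sym; trans; cong; subst)
open import Relation.Nullary.Decidable using (Dec; from-yes; _×-dec_; _⊎-dec_; _→-dec_)

wt-paths : ∀ j k B → wt j (paths k B) ≡ wt (k + j) B
wt-paths j zero    B = refl
wt-paths j (suc k) B = trans (wt-paths (suc j) k B) (cong (λ i → wt i B) (+-suc k j))

weight-paths-fork : ∀ k B B' → weight (paths k (fork B B')) ≡ closedWeight k (weight B) (weight B')
weight-paths-fork k B B' =
  trans (wt-paths 0 k (fork B B')) (cong (λ i → closedWeight i (weight B) (weight B')) (+-identityʳ k))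

closed⇒paths-fork : ∀ {B} → Closed B → ∃₂ λ E E' → B ≡ paths (chainLen B) (fork E E')
closed⇒paths-fork (closed-fork {E} {E'}) = E , E' , refl
closed⇒paths-fork (closed-path c) with E , E' , eq ← closed⇒paths-fork c = E , E' , cong path eq

weights : List ℕ
weights = 0 ∷ 1 ∷ 2 ∷ 3 ∷ 5 ∷ 6 ∷ 10 ∷ 15 ∷ []

typeC-∈ : All (λ a → All (λ b → typeC a b ∈ weights) weights) weights
typeC-∈ = from-yes (all? (λ a → all? (λ b → typeC a b ∈? weights) weights) weights)

typeWeight-stable : All (λ t → ∀ m → typeWeight t (7 + m) ≡ typeWeight t 7) weights
typeWeight-stable =
  (λ _ → refl) ∷ (λ _ → refl) ∷ (λ _ → refl) ∷ (λ _ → refl) ∷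
  (λ _ → refl) ∷ (λ _ → refl) ∷ (λ _ → refl) ∷ (λ _ → refl) ∷ []

closedWeight-cap : ∀ {c c'} → c ∈ weights → c' ∈ weights →
                   ∀ k → closedWeight k c c' ≡ closedWeight (7 ⊓ k) c c'
closedWeight-cap _ _ 0 = refl
closedWeight-cap _ _ 1 = refl
closedWeight-cap _ _ 2 = refl
closedWeight-cap _ _ 3 = refl
closedWeight-cap _ _ 4 = refl
closedWeight-cap _ _ 5 = refl
closedWeight-cap _ _ 6 = refl
closedWeight-cap c∈ c'∈ (suc (suc (suc (suc (suc (suc (suc m))))))) =
  lookup typeWeight-stable (lookup (lookup typeC-∈ c∈) c'∈) m

⊓7-∈-upTo8 : ∀ k → 7 ⊓ k ∈ upTo 8
⊓7-∈-upTo8 k = ∈-upTo⁺ (s≤s (m⊓n≤m 7 k))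

closedWeight-∈ : ∀ {c c'} → c ∈ weights → c' ∈ weights → ∀ k → closedWeight k c c' ∈ weights
closedWeight-∈ c∈ c'∈ k =
  subst (_∈ weights) (sym (closedWeight-cap c∈ c'∈ k)) (lookup (lookup (lookup table (⊓7-∈-upTo8 k)) c∈) c'∈)
  where
    table : All (λ k → All (λ c → All (λ c' → closedWeight k c c' ∈ weights) weights) weights) (upTo 8)
    table = from-yes (all? (λ k → all? (λ c → all? (λ c' → closedWeight k c c' ∈? weights) weights) weights) (upTo 8))

wt-∈ : ∀ k B → wt k B ∈ weights
wt-∈ k leaf        = there (here refl)
wt-∈ k (path B)    = wt-∈ (suc k) B
wt-∈ k (fork B B') = closedWeight-∈ (wt-∈ 0 B) (wt-∈ 0 B') k

typeC≡2⇒even : All (λ a → All (λ b → typeC a b ≡ 2 → 2 ∣ a × 2 ∣ b) weights) weights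
typeC≡2⇒even = from-yes (all? (λ a → all? (λ b → typeC a b ≟ 2 →-dec 2 ∣? a ×-dec 2 ∣? b) weights) weights)

closedWeight-3-even : All (λ c → All (λ c' → 2 ∣ closedWeight 3 c c') weights) weights
closedWeight-3-even = from-yes (all? (λ c → all? (λ c' → 2 ∣? closedWeight 3 c c') weights) weights)

closed-length-3-even : ∀ {X} → Closed X → chainLen X ≡ 3 → 2 ∣ weight X
closed-length-3-even c len with E , E' , X≡ ← closed⇒paths-fork c =
  subst (2 ∣_) (sym (cong weight (trans X≡ (cong (λ n → paths n (fork E E')) len))))
    (lookup (lookup closedWeight-3-even (wt-∈ 0 E)) (wt-∈ 0 E'))

B1at⇒even : ∀ {X Y Z} → B1at X Y Z → 2 ∣ weight X × 2 ∣ weight Y × 2 ∣ weight Z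
B1at⇒even {X} {Y} {Z} (closedX , type≡) with typeC≡2 , len≡3 ← ,-injective type≡ =
  closed-length-3-even closedX len≡3 , lookup (lookup typeC≡2⇒even (wt-∈ 0 Y)) (wt-∈ 0 Z) typeC≡2

common-divisor⇒1<gcd : ∀ {p x y z} → 1 < p → p ∣ x → p ∣ y → p ∣ z → 0 < x → 1 < gcd (gcd x y) z
common-divisor⇒1<gcd {x = x} {y} {z} 1<p p∣x p∣y p∣z 0<x =
  <-≤-trans 1<p (∣⇒≤ {{≢-nonZero gcd≢0}} (gcd-greatest (gcd-greatest p∣x p∣y) p∣z))
  where
    gcd≢0 : gcd (gcd x y) z ≢ 0
    gcd≢0 = <⇒≢ 0<x ∘ sym ∘ gcd[m,n]≡0⇒m≡0 {x} {y} ∘ gcd[m,n]≡0⇒m≡0 {gcd x y} {z}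

BadWeights : ℕ → ℕ → ℕ → Set
BadWeights x y z = SameBig x y ⊎ SameBig x z ⊎ SameBig y z ⊎ 1 < gcd (gcd x y) z

badWeights? : ∀ x y z → Dec (BadWeights x y z)
badWeights? x y z = sameBig? x y ⊎-dec sameBig? x z ⊎-dec sameBig? y z ⊎-dec 1 <? gcd (gcd x y) z
  where
    sameBig? : ∀ m n → Dec (SameBig m n)
    sameBig? m n = m ≟ n ×-dec (m ≟ 6 ⊎-dec m ≟ 10 ⊎-dec m ≟ 15)

bad⇔badWeights : ∀ {X Y Z} → 0 < weight X → 0 < weight Y → 0 < weight Z →
                 Bad X Y Z ⇔ BadWeights (weight X) (weight Y) (weight Z)
bad⇔badWeights {X} {Y} {Z} 0<x 0<y 0<z = mk⇔ to from
  where
    gcd-bad : 2 ∣ weight X → 2 ∣ weight Y → 2 ∣ weight Z → BadWeights (weight X) (weight Y) (weight Z)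
    gcd-bad 2∣x 2∣y 2∣z = inj₂ (inj₂ (inj₂ (common-divisor⇒1<gcd (s≤s (s≤s z≤n)) 2∣x 2∣y 2∣z 0<x)))

    to : Bad X Y Z → BadWeights (weight X) (weight Y) (weight Z)
    to (b1-X b1) with 2∣x , 2∣y , 2∣z ← B1at⇒even {X} {Y} {Z} b1 = gcd-bad 2∣x 2∣y 2∣z
    to (b1-Y b1) with 2∣y , 2∣x , 2∣z ← B1at⇒even {Y} {X} {Z} b1 = gcd-bad 2∣x 2∣y 2∣z
    to (b1-Z b1) with 2∣z , 2∣x , 2∣y ← B1at⇒even {Z} {X} {Y} b1 = gcd-bad 2∣x 2∣y 2∣z
    to (b2-XY s) = inj₁ s
    to (b2-XZ s) = inj₂ (inj₁ s)
    to (b2-YZ s) = inj₂ (inj₂ (inj₁ s))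
    to (b3 _ _ _ 1<gcd) = inj₂ (inj₂ (inj₂ 1<gcd))

    from : BadWeights (weight X) (weight Y) (weight Z) → Bad X Y Z
    from (inj₁ s) = b2-XY s
    from (inj₂ (inj₁ s)) = b2-XZ s
    from (inj₂ (inj₂ (inj₁ s))) = b2-YZ s
    from (inj₂ (inj₂ (inj₂ 1<gcd))) = b3 0<x 0<y 0<z 1<gcd

-- a and b are the weights received by v and u along the chain joining them.
Transfer : ℕ → ℕ → ℕ → ℕ → ℕ → ℕ → Set
Transfer a b c c' d d' = 0 < a → 0 < b → BadWeights b c c' → BadWeights a d d'

closedWeight-transfer : ∀ {c c' d d'} → c ∈ weights → c' ∈ weights → d ∈ weights → d' ∈ weights →
                        ∀ k → 2 ≤ k → Transfer (closedWeight k c c') (closedWeight k d d') c c' d d'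
closedWeight-transfer c∈ c'∈ d∈ d'∈ k 2≤k
  rewrite closedWeight-cap c∈ c'∈ k | closedWeight-cap d∈ d'∈ k =
  lookup (lookup (lookup (lookup (lookup table (⊓7-∈-upTo8 k) (⊓-glb (s≤s (s≤s z≤n)) 2≤k)) c∈) c'∈) d∈) d'∈
  where
    transfer? : ∀ a b c c' d d' → Dec (Transfer a b c c' d d')
    transfer? a b c c' d d' = 0 <? a →-dec 0 <? b →-dec badWeights? b c c' →-dec badWeights? a d d'

    table : All (λ k → 2 ≤ k → All (λ c → All (λ c' → All (λ d → All (λ d' →
              Transfer (closedWeight k c c') (closedWeight k d d') c c' d d')
              weights) weights) weights) weights) (upTo 8)
    table = from-yes (all? (λ k → 2 ≤? k →-dec all? (λ c → all? (λ c' → all? (λ d → all? (λ d' →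
              transfer? (closedWeight k c c') (closedWeight k d d') c c' d d')
              weights) weights) weights) weights) (upTo 8))

bad-transfer : ∀ k (C C' D D' : Branch) → 2 ≤ k →
               0 < weight (paths k (fork C C')) → 0 < weight (paths k (fork D D')) →
               0 < weight C → 0 < weight C' → 0 < weight D → 0 < weight D' →
               Bad (paths k (fork D D')) C C' → Bad (paths k (fork C C')) D D'
bad-transfer k C C' D D' 2≤k 0<a 0<b 0<c 0<c' 0<d 0<d' =
  Equivalence.from (bad⇔badWeights 0<a 0<d 0<d') ∘ transfer 0<a 0<b ∘ Equivalence.to (bad⇔badWeights 0<b 0<c 0<c')
  where
    transfer : Transfer (weight (paths k (fork C C'))) (weight (paths k (fork D D')))
                        (weight C) (weight C') (weight D) (weight D')
    transfer rewrite weight-paths-fork k C C' | weight-paths-fork k D D' =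
      closedWeight-transfer (wt-∈ 0 C) (wt-∈ 0 C') (wt-∈ 0 D) (wt-∈ 0 D') k 2≤k

lemma2 : (k : ℕ) (C C' D D' : Branch) →
         2 ≤ k →
         0 < weight (paths k (fork C C')) →
         0 < weight (paths k (fork D D')) →
         0 < weight C → 0 < weight C' →
         0 < weight D → 0 < weight D' →
         Bad (paths k (fork D D')) C C' ⇔ Bad (paths k (fork C C')) D D'
lemma2 k C C' D D' 2≤k 0<a 0<b 0<c 0<c' 0<d 0<d' =
  mk⇔ (bad-transfer k C C' D D' 2≤k 0<a 0<b 0<c 0<c' 0<d 0<d')
      (bad-transfer k D D' C C' 2≤k 0<b 0<a 0<d 0<d' 0<c 0<c')
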